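{- Let $X(t,x,y)=\sum_G t^{\mathrm{xfd}(G)}x^{\#H(G)}y^{\#U(G)}$, the sum over all bargraphs $G$. Then $$X=ty\,\frac{1+x-y-2tx-xy-\sqrt{(1-y)(1-2x-y-2xy+x^2-x^2y)}}{2\bigl(1-t-(1-t)y+(t^2-t)x+txy\bigr)}.$$
   Context: A bargraph is a lattice path with steps $U=(0,1)$, $H=(1,0)$, $D=(0,-1)$, identified with its word over $\{U,H,D\}$, that starts at the origin, ends on the $x$-axis, stays strictly above the $x$-axis except at its endpoints, and contains no two consecutive steps $UD$ or $DU$ (the empty path is not a bargraph). $\#H(G)$, $\#U(G)$ denote the numbers of $H$ and $U$ steps. $\mathrm{xfd}(G)$, the $x$-coordinate of the first descent, is the number of $H$ steps preceding the first $D$ step of $G$. -}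

module Defs where

open import Data.Bool using (Bool; true; false; _∧_; not)
open import Data.Nat using (ℕ; zero; suc; _+_; _*_; _∸_; _≡ᵇ_)
open import Data.Integer as ℤ using (ℤ; +_)
open import Data.List using (List; []; _∷_; length; filterᵇ; concatMap)
open import Relation.Binary.PropositionalEquality using (_≡_)
open import Data.Product using (_×_)

data Step : Set where
  U H D : Step

words : ℕ → List (List Step)
words zero    = [] ∷ []
words (suc n) = concatMap (λ w → (U ∷ w) ∷ (H ∷ w) ∷ (D ∷ w) ∷ []) (words n)

stays : ℕ → List Step → Bool
stays zero          _             = false
stays (suc h)       []            = false
stays (suc h)       (U ∷ w)       = stays (suc (suc h)) w
stays (suc h)       (H ∷ w)       = stays (suc h) w
stays (suc zero)    (D ∷ [])      = true
stays (suc zero)    (D ∷ _ ∷ _)   = false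
stays (suc (suc h)) (D ∷ w)       = stays (suc h) w

noPeakValley : List Step → Bool
noPeakValley []            = true
noPeakValley (_ ∷ [])      = true
noPeakValley (U ∷ D ∷ _)   = false
noPeakValley (D ∷ U ∷ _)   = false
noPeakValley (a ∷ b ∷ w)   = noPeakValley (b ∷ w)

-- a (nonempty) path from the origin to the x-axis, strictly above the
-- x-axis except at its two endpoints (as a curve: so the first step
-- must be U), with no UD / DU.
isBargraph : List Step → Bool
isBargraph []      = false
isBargraph (U ∷ w) = stays 1 w ∧ noPeakValley (U ∷ w)
isBargraph (H ∷ w) = false
isBargraph (D ∷ w) = false

#H : List Step → ℕ
#H []      = 0
#H (H ∷ w) = suc (#H w)
#H (_ ∷ w) = #H w

#U : List Step → ℕ
#U []      = 0
#U (U ∷ w) = suc (#U w)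
#U (_ ∷ w) = #U w

xfd : List Step → ℕ
xfd []      = 0
xfd (D ∷ w) = 0
xfd (H ∷ w) = suc (xfd w)
xfd (U ∷ w) = xfd w

-- Formal power series in t, x, y with integer coefficients:
-- f i j k = coefficient of t^i x^j y^k.

FPS : Set
FPS = ℕ → ℕ → ℕ → ℤ

_≋_ : FPS → FPS → Set
f ≋ g = ∀ i j k → f i j k ≡ g i j k

sumTo : ℕ → (ℕ → ℤ) → ℤ
sumTo zero    f = f 0
sumTo (suc n) f = sumTo n f ℤ.+ f (suc n)

_⊕_ : FPS → FPS → FPS
(f ⊕ g) i j k = f i j k ℤ.+ g i j k

_⊖_ : FPS → FPS → FPS
(f ⊖ g) i j k = f i j k ℤ.- g i j k

_⊛_ : FPS → FPS → FPS
(f ⊛ g) i j k =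
  sumTo i λ a → sumTo j λ b → sumTo k λ c →
    f a b c ℤ.* g (i ∸ a) (j ∸ b) (k ∸ c)

mono : ℤ → ℕ → ℕ → ℕ → FPS
mono c a b d i j k with (i ≡ᵇ a) ∧ (j ≡ᵇ b) ∧ (k ≡ᵇ d)
... | true  = c
... | false = + 0

infixl 6 _⊕_ _⊖_
infix 4 _≋_
infixl 7 _⊛_

𝟙 𝕥 𝕩 𝕪 : FPS
𝟙 = mono (+ 1) 0 0 0
𝕥 = mono (+ 1) 1 0 0
𝕩 = mono (+ 1) 0 1 0
𝕪 = mono (+ 1) 0 0 1

𝟚 : FPS
𝟚 = mono (+ 2) 0 0 0

-- A bargraph with #H = j and #U = k has #D = k, hence length j + 2k,
-- so its coefficient is a finite count over words of that length.

X : FPS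
X i j k = + length (filterᵇ
  (λ w → isBargraph w ∧ (xfd w ≡ᵇ i) ∧ (#H w ≡ᵇ j) ∧ (#U w ≡ᵇ k))
  (words (j + 2 * k)))

-- The square root: the radicand P = (1-y)(1-2x-y-2xy+x^2-x^2 y) has
-- constant term 1, and √P denotes the unique power series S with
-- S^2 = P and constant term 1.

radicand : FPS
radicand = (𝟙 ⊖ 𝕪) ⊛ (𝟙 ⊖ 𝟚 ⊛ 𝕩 ⊖ 𝕪 ⊖ 𝟚 ⊛ 𝕩 ⊛ 𝕪 ⊕ 𝕩 ⊛ 𝕩 ⊖ 𝕩 ⊛ 𝕩 ⊛ 𝕪)

IsSqrtRadicand : FPS → Set
IsSqrtRadicand S = (S ⊛ S ≋ radicand) × (S 0 0 0 ≡ + 1)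

numer₀ : FPS
numer₀ = 𝟙 ⊕ 𝕩 ⊖ 𝕪 ⊖ 𝟚 ⊛ 𝕥 ⊛ 𝕩 ⊖ 𝕩 ⊛ 𝕪

denom : FPS
denom = 𝟙 ⊖ 𝕥 ⊖ (𝟙 ⊖ 𝕥) ⊛ 𝕪 ⊕ (𝕥 ⊛ 𝕥 ⊖ 𝕥) ⊛ 𝕩 ⊕ 𝕥 ⊛ 𝕩 ⊛ 𝕪

-- A bargraph is U followed by a first passage from height 1 down to the x-axis avoiding UD and DU.
-- Splitting such passages at their first step, and passages from height 2 at their first return
-- to height 1, shows that the series u(x,y) of first passages from height 1 after a U satisfies
-- the quadratic u = x(1+u) + yu(1 + x(1+u)), and its t-refinement v the linear equation
-- v = tx(1+v) + yv(1 + x(1+u)), with X = yv. The discriminant of the quadratic is the radicand,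
-- with square root 1 - x - y - xy - 2xyu, and eliminating u and v gives the closed form. The
-- square root is unique: (S - S₀)(S + S₀) = 0 and S + S₀ has constant term 2.
module Submission where

open import Defs
open import Algebra.Bundles using (CommutativeSemiring; CommutativeRing)
open import Data.Nat as ℕ using (ℕ; zero; suc; _∸_; _≤_; _<_; z≤n; s≤s)
import Data.Nat.Properties as ℕ
open import Data.Product using (Σ; _×_; _,_; proj₁; proj₂)
open import Function using (_∘_; _$_)
open import Data.Integer as ℤ using (ℤ; +_)
import Data.Integer.Properties as ℤ
open import Data.Bool using (true; false)
open import Data.Empty using (⊥-elim)
open import Data.Sum using (inj₁; inj₂)
open import Relation.Nullary using (yes; no)
open import Relation.Binary.PropositionalEquality as ≡ using (_≡_; _≢_)

module RangeSum {c ℓ} (S : CommutativeSemiring c ℓ) where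
  open CommutativeSemiring S
  open import Algebra.Properties.CommutativeSemigroup +-commutativeSemigroup using (interchange)
  open import Relation.Binary.Reasoning.Setoid setoid

  Σ≤ : ℕ → (ℕ → Carrier) → Carrier
  Σ≤ zero    f = f 0
  Σ≤ (suc n) f = Σ≤ n f + f (suc n)

  Σ≤-cong : ∀ n {f g} → (∀ a → a ≤ n → f a ≈ g a) → Σ≤ n f ≈ Σ≤ n g
  Σ≤-cong zero    f≈g = f≈g 0 z≤n
  Σ≤-cong (suc n) f≈g =
    +-cong (Σ≤-cong n (λ a a≤n → f≈g a (ℕ.m≤n⇒m≤1+n a≤n))) (f≈g (suc n) ℕ.≤-refl)

  Σ≤-zero : ∀ n {f} → (∀ a → a ≤ n → f a ≈ 0#) → Σ≤ n f ≈ 0#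
  Σ≤-zero zero    f≈0 = f≈0 0 z≤n
  Σ≤-zero (suc n) f≈0 = trans
    (+-cong (Σ≤-zero n (λ a a≤n → f≈0 a (ℕ.m≤n⇒m≤1+n a≤n))) (f≈0 (suc n) ℕ.≤-refl))
    (+-identityˡ 0#)

  Σ≤-distrib-+ : ∀ n f g → Σ≤ n (λ a → f a + g a) ≈ Σ≤ n f + Σ≤ n g
  Σ≤-distrib-+ zero    f g = refl
  Σ≤-distrib-+ (suc n) f g = trans (+-congʳ (Σ≤-distrib-+ n f g)) (interchange _ _ _ _)

  *-distribˡ-Σ≤ : ∀ n x f → x * Σ≤ n f ≈ Σ≤ n (λ a → x * f a)
  *-distribˡ-Σ≤ zero    x f = refl
  *-distribˡ-Σ≤ (suc n) x f = trans (distribˡ x _ _) (+-congʳ (*-distribˡ-Σ≤ n x f))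

  *-distribʳ-Σ≤ : ∀ n x f → Σ≤ n f * x ≈ Σ≤ n (λ a → f a * x)
  *-distribʳ-Σ≤ zero    x f = refl
  *-distribʳ-Σ≤ (suc n) x f = trans (distribʳ x _ _) (+-congʳ (*-distribʳ-Σ≤ n x f))

  Σ≤-suc-head : ∀ n f → Σ≤ (suc n) f ≈ f 0 + Σ≤ n (λ a → f (suc a))
  Σ≤-suc-head zero    f = refl
  Σ≤-suc-head (suc n) f = trans (+-congʳ (Σ≤-suc-head n f)) (+-assoc _ _ _)

  Σ≤-reverse : ∀ n f → Σ≤ n f ≈ Σ≤ n (λ a → f (n ∸ a))
  Σ≤-reverse zero    f = refl
  Σ≤-reverse (suc n) f = begin
    Σ≤ n f + f (suc n)                  ≈⟨ +-congʳ (Σ≤-reverse n f) ⟩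
    Σ≤ n (λ a → f (n ∸ a)) + f (suc n)  ≈⟨ +-comm _ _ ⟩
    f (suc n) + Σ≤ n (λ a → f (n ∸ a))  ≈⟨ Σ≤-suc-head n (λ a → f (suc n ∸ a)) ⟨
    Σ≤ (suc n) (λ a → f (suc n ∸ a))    ∎

  -- Both sides sum T b c over the triangle b + c ≤ n.
  Σ≤-triangle : ∀ n (T : ℕ → ℕ → Carrier) →
    Σ≤ n (λ a → Σ≤ a (λ b → T b (a ∸ b))) ≈ Σ≤ n (λ b → Σ≤ (n ∸ b) (T b))
  Σ≤-triangle zero    T = refl
  Σ≤-triangle (suc n) T = begin
    Σ≤ n (λ a → Σ≤ a (λ b → T b (a ∸ b))) + Σ≤ (suc n) (λ b → T b (suc n ∸ b))
      ≈⟨ +-congʳ (Σ≤-triangle n T) ⟩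
    Σ≤ n (λ b → Σ≤ (n ∸ b) (T b)) + (Σ≤ n (λ b → T b (suc n ∸ b)) + T (suc n) (n ∸ n))
      ≈⟨ +-assoc _ _ _ ⟨
    (Σ≤ n (λ b → Σ≤ (n ∸ b) (T b)) + Σ≤ n (λ b → T b (suc n ∸ b))) + T (suc n) (n ∸ n)
      ≈⟨ +-congʳ (Σ≤-distrib-+ n _ _) ⟨
    Σ≤ n (λ b → Σ≤ (n ∸ b) (T b) + T b (suc n ∸ b)) + T (suc n) (n ∸ n)
      ≈⟨ +-cong (Σ≤-cong n extend) last ⟩
    Σ≤ (suc n) (λ b → Σ≤ (suc n ∸ b) (T b)) ∎
    where
    extend : ∀ b → b ≤ n → Σ≤ (n ∸ b) (T b) + T b (suc n ∸ b) ≈ Σ≤ (suc n ∸ b) (T b)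
    extend b b≤n rewrite ℕ.+-∸-assoc 1 b≤n = refl
    last : T (suc n) (n ∸ n) ≈ Σ≤ (n ∸ n) (T (suc n))
    last rewrite ℕ.n∸n≡0 n = refl

  Σ≤-single : ∀ n {a₀} f → a₀ ≤ n → (∀ a → a ≤ n → a ≢ a₀ → f a ≈ 0#) → Σ≤ n f ≈ f a₀
  Σ≤-single zero    f z≤n f≈0 = refl
  Σ≤-single (suc n) {a₀} f a₀≤1+n f≈0 with a₀ ℕ.≟ suc n
  ... | yes ≡.refl = trans (+-congʳ (Σ≤-zero n (λ a a≤n → f≈0 a (ℕ.m≤n⇒m≤1+n a≤n) (ℕ.<⇒≢ (s≤s a≤n)))))
                           (+-identityˡ _)
  ... | no a₀≢1+n  = trans (+-cong (Σ≤-single n f (ℕ.s≤s⁻¹ (ℕ.≤∧≢⇒< a₀≤1+n a₀≢1+n))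
                                      (λ a a≤n → f≈0 a (ℕ.m≤n⇒m≤1+n a≤n)))
                                    (f≈0 (suc n) ℕ.≤-refl (a₀≢1+n ∘ ≡.sym)))
                           (+-identityʳ _)

  Σ≤³-single : ∀ i j k {a₀ b₀ c₀} (f : ℕ → ℕ → ℕ → Carrier) → a₀ ≤ i → b₀ ≤ j → c₀ ≤ k →
    (∀ a b c → a ≤ i → b ≤ j → c ≤ k → (a , b , c) ≢ (a₀ , b₀ , c₀) → f a b c ≈ 0#) →
    Σ≤ i (λ a → Σ≤ j (λ b → Σ≤ k (λ c → f a b c))) ≈ f a₀ b₀ c₀
  Σ≤³-single i j k f a₀≤i b₀≤j c₀≤k f≈0 =
    trans (Σ≤-single i _ a₀≤i λ a a≤i a≢a₀ → Σ≤-zero j λ b b≤j → Σ≤-zero k λ c c≤k →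
             f≈0 a b c a≤i b≤j c≤k (a≢a₀ ∘ ≡.cong proj₁))
    (trans (Σ≤-single j _ b₀≤j λ b b≤j b≢b₀ → Σ≤-zero k λ c c≤k →
             f≈0 _ b c a₀≤i b≤j c≤k (b≢b₀ ∘ ≡.cong (proj₁ ∘ proj₂)))
           (Σ≤-single k _ c₀≤k λ c c≤k c≢c₀ →
             f≈0 _ _ c a₀≤i b₀≤j c≤k (c≢c₀ ∘ ≡.cong (proj₂ ∘ proj₂))))

module PowerSeries {c ℓ} (R : CommutativeRing c ℓ) where
  open CommutativeRing R
  open RangeSum commutativeSemiring public
  import Algebra.Construct.Pointwise ℕ as Pointwise
  open import Relation.Binary.Reasoning.Setoid setoid

  Series : Set c
  Series = ℕ → Carrier

  infix  4 _≐_
  infixl 6 _⊞_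
  infixl 7 _⋆_

  _≐_ : Series → Series → Set ℓ
  f ≐ g = ∀ n → f n ≈ g n

  _⊞_ : Series → Series → Series
  (f ⊞ g) n = f n + g n

  ⊟_ : Series → Series
  (⊟ f) n = - f n

  _⋆_ : Series → Series → Series
  (f ⋆ g) n = Σ≤ n (λ a → f a * g (n ∸ a))

  const : Carrier → Series
  const r zero    = r
  const r (suc _) = 0#

  z : Series
  z (suc zero) = 1#
  z _          = 0#

  ⋆-cong : ∀ {f f′ g g′} → f ≐ f′ → g ≐ g′ → f ⋆ g ≐ f′ ⋆ g′
  ⋆-cong f≐f′ g≐g′ n = Σ≤-cong n (λ a _ → *-cong (f≐f′ a) (g≐g′ (n ∸ a)))

  ⋆-comm : ∀ f g → f ⋆ g ≐ g ⋆ f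
  ⋆-comm f g n = begin
    Σ≤ n (λ a → f a * g (n ∸ a))                ≈⟨ Σ≤-reverse n _ ⟩
    Σ≤ n (λ a → f (n ∸ a) * g (n ∸ (n ∸ a)))    ≈⟨ Σ≤-cong n swap ⟩
    Σ≤ n (λ a → g a * f (n ∸ a))                ∎
    where
    swap : ∀ a → a ≤ n → f (n ∸ a) * g (n ∸ (n ∸ a)) ≈ g a * f (n ∸ a)
    swap a a≤n rewrite ℕ.m∸[m∸n]≡n a≤n = *-comm _ _

  ⋆-assoc : ∀ f g h → (f ⋆ g) ⋆ h ≐ f ⋆ (g ⋆ h)
  ⋆-assoc f g h n = begin
    Σ≤ n (λ a → Σ≤ a (λ b → f b * g (a ∸ b)) * h (n ∸ a))
      ≈⟨ Σ≤-cong n (λ a _ → *-distribʳ-Σ≤ a _ _) ⟩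
    Σ≤ n (λ a → Σ≤ a (λ b → (f b * g (a ∸ b)) * h (n ∸ a)))
      ≈⟨ Σ≤-cong n (λ a a≤n → Σ≤-cong a (λ b b≤a → regroup a b a≤n b≤a)) ⟩
    Σ≤ n (λ a → Σ≤ a (λ b → T b (a ∸ b)))
      ≈⟨ Σ≤-triangle n T ⟩
    Σ≤ n (λ b → Σ≤ (n ∸ b) (T b))
      ≈⟨ Σ≤-cong n (λ b _ → *-distribˡ-Σ≤ (n ∸ b) _ _) ⟨
    Σ≤ n (λ b → f b * Σ≤ (n ∸ b) (λ c → g c * h (n ∸ b ∸ c))) ∎
    where
    T : ℕ → ℕ → Carrier
    T b c = f b * (g c * h (n ∸ b ∸ c))
    regroup : ∀ a b → a ≤ n → b ≤ a → (f b * g (a ∸ b)) * h (n ∸ a) ≈ T b (a ∸ b)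
    regroup a b a≤n b≤a rewrite ℕ.∸-+-assoc n b (a ∸ b) | ℕ.m+[n∸m]≡n b≤a = *-assoc _ _ _

  const-⋆ : ∀ r f → const r ⋆ f ≐ λ n → r * f n
  const-⋆ r f zero    = refl
  const-⋆ r f (suc n) = begin
    Σ≤ (suc n) (λ a → const r a * f (suc n ∸ a))       ≈⟨ Σ≤-suc-head n _ ⟩
    r * f (suc n) + Σ≤ n (λ a → 0# * f (n ∸ a))        ≈⟨ +-congˡ (Σ≤-zero n (λ a _ → zeroˡ _)) ⟩
    r * f (suc n) + 0#                                 ≈⟨ +-identityʳ _ ⟩
    r * f (suc n)                                      ∎

  z-⋆-zero : ∀ f → (z ⋆ f) 0 ≈ 0#
  z-⋆-zero f = zeroˡ _

  z-⋆-suc : ∀ f n → (z ⋆ f) (suc n) ≈ f n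
  z-⋆-suc f n = begin
    Σ≤ (suc n) (λ a → z a * f (suc n ∸ a))             ≈⟨ Σ≤-suc-head n _ ⟩
    0# * f (suc n) + Σ≤ n (λ a → z (suc a) * f (n ∸ a)) ≈⟨ +-cong (zeroˡ _) (Σ≤-single n _ z≤n rest) ⟩
    0# + 1# * f n                                      ≈⟨ +-identityˡ _ ⟩
    1# * f n                                           ≈⟨ *-identityˡ _ ⟩
    f n                                                ∎
    where
    rest : ∀ a → a ≤ n → a ≢ 0 → z (suc a) * f (n ∸ a) ≈ 0#
    rest zero    _ 0≢0 = ⊥-elim (0≢0 ≡.refl)
    rest (suc a) _ _   = zeroˡ _

  commutativeRing : CommutativeRing c ℓ
  commutativeRing = record
    { Carrier = Series ; _≈_ = _≐_ ; _+_ = _⊞_ ; _*_ = _⋆_ ; -_ = ⊟_ ; 0# = λ _ → 0# ; 1# = const 1#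
    ; isCommutativeRing = record
      { isRing = record
        { +-isAbelianGroup = Pointwise.isAbelianGroup +-isAbelianGroup
        ; *-cong = ⋆-cong
        ; *-assoc = ⋆-assoc
        ; *-identity = (λ f n → trans (const-⋆ 1# f n) (*-identityˡ _))
                     , (λ f n → trans (⋆-comm f (const 1#) n) (trans (const-⋆ 1# f n) (*-identityˡ _)))
        ; distrib = (λ f g h n → trans (Σ≤-cong n (λ a _ → distribˡ _ _ _)) (Σ≤-distrib-+ n _ _))
                  , (λ f g h n → trans (Σ≤-cong n (λ a _ → distribʳ _ _ _)) (Σ≤-distrib-+ n _ _)) }
      ; *-comm = ⋆-comm } }

  Σ≤-at : ∀ n (F : ℕ → Series) m →
    RangeSum.Σ≤ (CommutativeRing.commutativeSemiring commutativeRing) n F m ≡ Σ≤ n (λ a → F a m)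
  Σ≤-at zero    F m = ≡.refl
  Σ≤-at (suc n) F m = ≡.cong (_+ F (suc n) m) (Σ≤-at n F m)

-- An FPS f, read as f i j k, is a series in t of series in x of series in y; the additive
-- structure of this iterated power series ring coincides with that of FPS definitionally.
module ℤ⟦y⟧   = PowerSeries ℤ.+-*-commutativeRing
module ℤ⟦xy⟧  = PowerSeries ℤ⟦y⟧.commutativeRing
module ℤ⟦txy⟧ = PowerSeries ℤ⟦xy⟧.commutativeRing

sumTo≡Σ≤ : ∀ n F → sumTo n F ≡ ℤ⟦y⟧.Σ≤ n F
sumTo≡Σ≤ zero    F = ≡.refl
sumTo≡Σ≤ (suc n) F = ≡.cong (ℤ._+ F (suc n)) (sumTo≡Σ≤ n F)

sumTo³≡Σ≤³ : ∀ i j k (F : ℕ → ℕ → ℕ → ℤ) → sumTo i (λ a → sumTo j (λ b → sumTo k (F a b)))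
                       ≡ ℤ⟦y⟧.Σ≤ i (λ a → ℤ⟦y⟧.Σ≤ j (λ b → ℤ⟦y⟧.Σ≤ k (F a b)))
sumTo³≡Σ≤³ i j k F =
  ≡.trans (sumTo≡Σ≤ i λ a → sumTo j (λ b → sumTo k (F a b))) (ℤ⟦y⟧.Σ≤-cong i λ a _ →
  ≡.trans (sumTo≡Σ≤ j λ b → sumTo k (F a b)) (ℤ⟦y⟧.Σ≤-cong j λ b _ → sumTo≡Σ≤ k (F a b)))

⊛≋⋆ : ∀ f g → f ⊛ g ≋ ℤ⟦txy⟧._⋆_ f g
⊛≋⋆ f g i j k = ≡.sym (begin
  ℤ⟦txy⟧._⋆_ f g i j k
    ≡⟨ ≡.cong (_$ k) (ℤ⟦xy⟧.Σ≤-at i _ j) ⟩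
  ℤ⟦xy⟧.Σ≤ i (λ a → ℤ⟦xy⟧._⋆_ (f a) (g (i ∸ a)) j) k
    ≡⟨ ℤ⟦y⟧.Σ≤-at i _ k ⟩
  ℤ⟦y⟧.Σ≤ i (λ a → ℤ⟦xy⟧._⋆_ (f a) (g (i ∸ a)) j k)
    ≡⟨ ℤ⟦y⟧.Σ≤-cong i (λ a _ → ℤ⟦y⟧.Σ≤-at j _ k) ⟩
  ℤ⟦y⟧.Σ≤ i (λ a → ℤ⟦y⟧.Σ≤ j (λ b → ℤ⟦y⟧._⋆_ (f a b) (g (i ∸ a) (j ∸ b)) k))
    ≡⟨ sumTo³≡Σ≤³ i j k (λ a b c → f a b c ℤ.* g (i ∸ a) (j ∸ b) (k ∸ c)) ⟨
  (f ⊛ g) i j k ∎)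
  where open ≡.≡-Reasoning

module ℤ⟦txy⟧-Ring = CommutativeRing ℤ⟦txy⟧.commutativeRing

constant : ℤ → FPS
constant c = mono c 0 0 0

constant≋const : ∀ c → constant c ≋ ℤ⟦txy⟧.const (ℤ⟦xy⟧.const (ℤ⟦y⟧.const c))
constant≋const c zero    zero    zero    = ≡.refl
constant≋const c zero    zero    (suc k) = ≡.refl
constant≋const c zero    (suc j) k       = ≡.refl
constant≋const c (suc i) j       k       = ≡.refl

FPS-commutativeRing : CommutativeRing _ _
FPS-commutativeRing = record
  { Carrier = FPS ; _≈_ = _≋_ ; _+_ = _⊕_ ; _*_ = _⊛_ ; -_ = λ f i j k → ℤ.- f i j k
  ; 0# = λ _ _ _ → + 0 ; 1# = 𝟙
  ; isCommutativeRing = record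
    { isRing = record
      { +-isAbelianGroup = ℤ⟦txy⟧-Ring.+-isAbelianGroup
      ; *-cong = λ {f} {f′} {g} {g′} f≋f′ g≋g′ →
          via ⊛≋⋆ f g , ℤ⟦txy⟧-Ring.*-cong f≋f′ g≋g′ , ⊛≋⋆ f′ g′
      ; *-assoc = λ f g h →
          via ⊛≋⋆ (f ⊛ g) h , ℤ⟦txy⟧-Ring.*-cong (⊛≋⋆ f g) (≋-refl h)
          ⨾ ℤ⟦txy⟧-Ring.*-assoc f g h ⨾ ℤ⟦txy⟧-Ring.*-cong (≋-refl f) (≋-sym (⊛≋⋆ g h)) , ⊛≋⋆ f (g ⊛ h)
      ; *-identity = ⊛-identityˡ , λ f → ⊛-comm f 𝟙 ⨾ ⊛-identityˡ f
      ; distrib = (λ f g h → ⊛-comm f (g ⊕ h) ⨾ ⊛-distribʳ f g h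
                           ⨾ ℤ⟦txy⟧-Ring.+-cong (⊛-comm g f) (⊛-comm h f))
                , ⊛-distribʳ }
    ; *-comm = ⊛-comm } }
  where
  infixr 5 _⨾_
  _⨾_ : ∀ {f g h} → f ≋ g → g ≋ h → f ≋ h
  (f≋g ⨾ g≋h) i j k = ≡.trans (f≋g i j k) (g≋h i j k)
  ≋-refl : ∀ f → f ≋ f
  ≋-refl f i j k = ≡.refl
  ≋-sym : ∀ {f g} → f ≋ g → g ≋ f
  ≋-sym f≋g i j k = ≡.sym (f≋g i j k)
  via_,_,_ : ∀ {f g f′ g′} → f ≋ f′ → f′ ≋ g′ → g ≋ g′ → f ≋ g
  via f≋f′ , f′≋g′ , g≋g′ = f≋f′ ⨾ f′≋g′ ⨾ ≋-sym g≋g′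
  ⊛-comm : ∀ f g → f ⊛ g ≋ g ⊛ f
  ⊛-comm f g = via ⊛≋⋆ f g , ℤ⟦txy⟧-Ring.*-comm f g , ⊛≋⋆ g f
  ⊛-identityˡ : ∀ f → 𝟙 ⊛ f ≋ f
  ⊛-identityˡ f = ⊛≋⋆ 𝟙 f ⨾ ℤ⟦txy⟧-Ring.*-cong (constant≋const (+ 1)) (≋-refl f) ⨾ ℤ⟦txy⟧-Ring.*-identityˡ f
  ⊛-distribʳ : ∀ f g h → (g ⊕ h) ⊛ f ≋ g ⊛ f ⊕ h ⊛ f
  ⊛-distribʳ f g h = via ⊛≋⋆ (g ⊕ h) f , ℤ⟦txy⟧-Ring.distribʳ f g h , ℤ⟦txy⟧-Ring.+-cong (⊛≋⋆ g f) (⊛≋⋆ h f)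

module FPS-Ring = CommutativeRing FPS-commutativeRing

𝕥≋z : 𝕥 ≋ ℤ⟦txy⟧.z
𝕥≋z zero          j       k       = ≡.refl
𝕥≋z (suc zero)    zero    zero    = ≡.refl
𝕥≋z (suc zero)    zero    (suc k) = ≡.refl
𝕥≋z (suc zero)    (suc j) k       = ≡.refl
𝕥≋z (suc (suc i)) j       k       = ≡.refl

𝕩≋z : 𝕩 ≋ ℤ⟦txy⟧.const ℤ⟦xy⟧.z
𝕩≋z zero    zero          k       = ≡.refl
𝕩≋z zero    (suc zero)    zero    = ≡.refl
𝕩≋z zero    (suc zero)    (suc k) = ≡.refl
𝕩≋z zero    (suc (suc j)) k       = ≡.refl
𝕩≋z (suc i) j             k       = ≡.refl

𝕪≋z : 𝕪 ≋ ℤ⟦txy⟧.const (ℤ⟦xy⟧.const ℤ⟦y⟧.z)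
𝕪≋z zero    zero    zero          = ≡.refl
𝕪≋z zero    zero    (suc zero)    = ≡.refl
𝕪≋z zero    zero    (suc (suc k)) = ≡.refl
𝕪≋z zero    (suc j) k             = ≡.refl
𝕪≋z (suc i) j       k             = ≡.refl

⊛≋⋆ˡ : ∀ {a b} f → a ≋ b → a ⊛ f ≋ ℤ⟦txy⟧._⋆_ b f
⊛≋⋆ˡ {a} f a≋b = FPS-Ring.trans (⊛≋⋆ a f) (ℤ⟦txy⟧-Ring.*-cong a≋b (FPS-Ring.refl {f}))

constant-⊛ : ∀ c f i j k → (constant c ⊛ f) i j k ≡ c ℤ.* f i j k
constant-⊛ c f i j k = ≡.trans (⊛≋⋆ˡ f (constant≋const c) i j k)
  (≡.trans (ℤ⟦txy⟧.const-⋆ _ f i j k) (≡.trans (ℤ⟦xy⟧.const-⋆ _ (f i) j k) (ℤ⟦y⟧.const-⋆ c (f i j) k)))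

𝕥-⊛-zero : ∀ f j k → (𝕥 ⊛ f) 0 j k ≡ + 0
𝕥-⊛-zero f j k = ≡.trans (⊛≋⋆ˡ f 𝕥≋z 0 j k) (ℤ⟦txy⟧.z-⋆-zero f j k)

𝕥-⊛-suc : ∀ f i j k → (𝕥 ⊛ f) (suc i) j k ≡ f i j k
𝕥-⊛-suc f i j k = ≡.trans (⊛≋⋆ˡ f 𝕥≋z (suc i) j k) (ℤ⟦txy⟧.z-⋆-suc f i j k)

𝕩-⊛-zero : ∀ f i k → (𝕩 ⊛ f) i 0 k ≡ + 0
𝕩-⊛-zero f i k = ≡.trans (⊛≋⋆ˡ f 𝕩≋z i 0 k)
  (≡.trans (ℤ⟦txy⟧.const-⋆ _ f i 0 k) (ℤ⟦xy⟧.z-⋆-zero (f i) k))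

𝕩-⊛-suc : ∀ f i j k → (𝕩 ⊛ f) i (suc j) k ≡ f i j k
𝕩-⊛-suc f i j k = ≡.trans (⊛≋⋆ˡ f 𝕩≋z i (suc j) k)
  (≡.trans (ℤ⟦txy⟧.const-⋆ _ f i (suc j) k) (ℤ⟦xy⟧.z-⋆-suc (f i) j k))

𝕪-⊛-zero : ∀ f i j → (𝕪 ⊛ f) i j 0 ≡ + 0
𝕪-⊛-zero f i j = ≡.trans (⊛≋⋆ˡ f 𝕪≋z i j 0)
  (≡.trans (ℤ⟦txy⟧.const-⋆ _ f i j 0) (≡.trans (ℤ⟦xy⟧.const-⋆ _ (f i) j 0) (ℤ⟦y⟧.z-⋆-zero (f i j))))

𝕪-⊛-suc : ∀ f i j k → (𝕪 ⊛ f) i j (suc k) ≡ f i j k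
𝕪-⊛-suc f i j k = ≡.trans (⊛≋⋆ˡ f 𝕪≋z i j (suc k))
  (≡.trans (ℤ⟦txy⟧.const-⋆ _ f i j (suc k)) (≡.trans (ℤ⟦xy⟧.const-⋆ _ (f i) j (suc k)) (ℤ⟦y⟧.z-⋆-suc (f i j) k)))

≤³∧≢⇒+< : ∀ {a b c i j k} → a ≤ i → b ≤ j → c ≤ k → (a , b , c) ≢ (i , j , k) →
  a ℕ.+ b ℕ.+ c < i ℕ.+ j ℕ.+ k
≤³∧≢⇒+< {a} {b} {c} {i} {j} {k} a≤i b≤j c≤k ≢ with a ℕ.≟ i | b ℕ.≟ j | c ℕ.≟ k
... | yes ≡.refl | yes ≡.refl | yes ≡.refl = ⊥-elim (≢ ≡.refl)
... | no a≢i     | _          | _          =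
  ℕ.+-mono-<-≤ (ℕ.+-mono-<-≤ (ℕ.≤∧≢⇒< a≤i a≢i) b≤j) c≤k
... | yes ≡.refl | no b≢j     | _          =
  ℕ.+-mono-<-≤ (ℕ.+-mono-≤-< (ℕ.≤-refl {a}) (ℕ.≤∧≢⇒< b≤j b≢j)) c≤k
... | yes ≡.refl | yes ≡.refl | no c≢k     =
  ℕ.+-mono-≤-< (ℕ.≤-refl {a ℕ.+ b}) (ℕ.≤∧≢⇒< c≤k c≢k)

⊛-lowest : ∀ f g i j k →
  (∀ a b c → a ≤ i → b ≤ j → c ≤ k → a ℕ.+ b ℕ.+ c < i ℕ.+ j ℕ.+ k → f a b c ≡ + 0) →
  (f ⊛ g) i j k ≡ f i j k ℤ.* g 0 0 0
⊛-lowest f g i j k f≡0 = begin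
  (f ⊛ g) i j k
    ≡⟨ sumTo³≡Σ≤³ i j k (λ a b c → f a b c ℤ.* g (i ∸ a) (j ∸ b) (k ∸ c)) ⟩
  ℤ⟦y⟧.Σ≤ i (λ a → ℤ⟦y⟧.Σ≤ j (λ b → ℤ⟦y⟧.Σ≤ k (λ c → f a b c ℤ.* g (i ∸ a) (j ∸ b) (k ∸ c))))
    ≡⟨ ℤ⟦y⟧.Σ≤³-single i j k _ ℕ.≤-refl ℕ.≤-refl ℕ.≤-refl (λ a b c a≤i b≤j c≤k ≢ →
         ≡.cong (ℤ._* _) (f≡0 a b c a≤i b≤j c≤k (≤³∧≢⇒+< a≤i b≤j c≤k ≢))) ⟩
  f i j k ℤ.* g (i ∸ i) (j ∸ j) (k ∸ k)
    ≡⟨ ≡.cong (f i j k ℤ.*_) (≡.cong₂ (λ p q → g p q (k ∸ k)) (ℕ.n∸n≡0 i) (ℕ.n∸n≡0 j)) ⟩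
  f i j k ℤ.* g 0 0 (k ∸ k)
    ≡⟨ ≡.cong (λ r → f i j k ℤ.* g 0 0 r) (ℕ.n∸n≡0 k) ⟩
  f i j k ℤ.* g 0 0 0 ∎
  where open ≡.≡-Reasoning

⊛≋0⇒≋0 : ∀ f g → f ⊛ g ≋ FPS-Ring.0# → g 0 0 0 ≢ + 0 → f ≋ FPS-Ring.0#
⊛≋0⇒≋0 f g fg≋0 g₀≢0 i j k = vanish (suc (i ℕ.+ j ℕ.+ k)) i j k ℕ.≤-refl
  where
  vanish : ∀ n i j k → i ℕ.+ j ℕ.+ k < n → f i j k ≡ + 0
  vanish (suc n) i j k <1+n with ℤ.i*j≡0⇒i≡0∨j≡0 (f i j k)
    (≡.trans (≡.sym (⊛-lowest f g i j k λ a b c _ _ _ lower →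
                      vanish n a b c (ℕ.<-≤-trans lower (ℕ.s≤s⁻¹ <1+n))))
             (fg≋0 i j k))
  ... | inj₁ fijk≡0 = fijk≡0
  ... | inj₂ g₀≡0   = ⊥-elim (g₀≢0 g₀≡0)

module FPS-Solver where
  open import Algebra.Solver.Ring.AlmostCommutativeRing
    using (fromCommutativeRing; _-Raw-AlmostCommutative⟶_)
  open import Data.Maybe using (Maybe; just; nothing)

  constant-homomorphism : ℤ.+-*-rawRing -Raw-AlmostCommutative⟶ fromCommutativeRing FPS-commutativeRing
  constant-homomorphism = record
    { ⟦_⟧    = constant
    ; +-homo = +-homo
    ; *-homo = λ a b i j k → ≡.sym (≡.trans (constant-⊛ a (constant b) i j k) (*-homo a b i j k))
    ; -‿homo = -‿homo
    ; 0-homo = 0-homo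
    ; 1-homo = FPS-Ring.refl }
    where
    +-homo : ∀ a b → constant (a ℤ.+ b) ≋ constant a ⊕ constant b
    +-homo a b zero    zero    zero    = ≡.refl
    +-homo a b zero    zero    (suc k) = ≡.refl
    +-homo a b zero    (suc j) k       = ≡.refl
    +-homo a b (suc i) j       k       = ≡.refl
    *-homo : ∀ a b i j k → a ℤ.* constant b i j k ≡ constant (a ℤ.* b) i j k
    *-homo a b zero    zero    zero    = ≡.refl
    *-homo a b zero    zero    (suc k) = ℤ.*-zeroʳ a
    *-homo a b zero    (suc j) k       = ℤ.*-zeroʳ a
    *-homo a b (suc i) j       k       = ℤ.*-zeroʳ a
    -‿homo : ∀ a → constant (ℤ.- a) ≋ FPS-Ring.- constant a
    -‿homo a zero    zero    zero    = ≡.refl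
    -‿homo a zero    zero    (suc k) = ≡.refl
    -‿homo a zero    (suc j) k       = ≡.refl
    -‿homo a (suc i) j       k       = ≡.refl
    0-homo : constant (+ 0) ≋ FPS-Ring.0#
    0-homo zero    zero    zero    = ≡.refl
    0-homo zero    zero    (suc k) = ≡.refl
    0-homo zero    (suc j) k       = ≡.refl
    0-homo (suc i) j       k       = ≡.refl

  constant-≟ : ∀ a b → Maybe (constant a ≋ constant b)
  constant-≟ a b with a ℤ.≟ b
  ... | yes ≡.refl = just FPS-Ring.refl
  ... | no  _      = nothing

  open import Algebra.Solver.Ring ℤ.+-*-rawRing (fromCommutativeRing FPS-commutativeRing)
    constant-homomorphism constant-≟ public

module Words where
  open import Data.Bool using (Bool; true; false)
  open import Data.List using (List; []; _∷_; _++_; take; drop; length; filterᵇ; concatMap)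
  open import Data.Nat using (_+_; _*_)
  open import Data.Nat.Tactic.RingSolver using (solve-∀)
  open ≡ using (cong; cong₂)
  open ≡.≡-Reasoning
  open import Algebra.Properties.CommutativeSemigroup ℕ.+-commutativeSemigroup using (interchange)
  module ℕ-Sum = RangeSum ℕ.+-*-commutativeSemiring

  take-length-++ : ∀ (u v : List Step) → take (length u) (u ++ v) ≡ u
  take-length-++ []      v = ≡.refl
  take-length-++ (s ∷ u) v = cong (s ∷_) (take-length-++ u v)

  drop-length-++ : ∀ (u v : List Step) → drop (length u) (u ++ v) ≡ v
  drop-length-++ []      v = ≡.refl
  drop-length-++ (s ∷ u) v = drop-length-++ u v

  indicator : Bool → ℕ
  indicator true  = 1
  indicator false = 0

  sumOver : List (List Step) → (List Step → ℕ) → ℕ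
  sumOver []       f = 0
  sumOver (w ∷ ws) f = f w + sumOver ws f

  length-filterᵇ : ∀ p ws → length (filterᵇ p ws) ≡ sumOver ws (indicator ∘ p)
  length-filterᵇ p []       = ≡.refl
  length-filterᵇ p (w ∷ ws) with p w
  ... | true  = cong suc (length-filterᵇ p ws)
  ... | false = length-filterᵇ p ws

  sumOver-cong : ∀ ws {f g} → (∀ w → f w ≡ g w) → sumOver ws f ≡ sumOver ws g
  sumOver-cong []       f≡g = ≡.refl
  sumOver-cong (w ∷ ws) f≡g = cong₂ _+_ (f≡g w) (sumOver-cong ws f≡g)

  sumOver-zero : ∀ ws {f} → (∀ w → f w ≡ 0) → sumOver ws f ≡ 0
  sumOver-zero []       f≡0 = ≡.refl
  sumOver-zero (w ∷ ws) f≡0 = cong₂ _+_ (f≡0 w) (sumOver-zero ws f≡0)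

  sumOver-distrib-+ : ∀ ws f g → sumOver ws (λ w → f w + g w) ≡ sumOver ws f + sumOver ws g
  sumOver-distrib-+ []       f g = ≡.refl
  sumOver-distrib-+ (w ∷ ws) f g =
    ≡.trans (cong (λ r → f w + g w + r) (sumOver-distrib-+ ws f g)) (interchange (f w) (g w) _ _)

  *-distribˡ-sumOver : ∀ c ws f → c * sumOver ws f ≡ sumOver ws (λ w → c * f w)
  *-distribˡ-sumOver c []       f = ℕ.*-zeroʳ c
  *-distribˡ-sumOver c (w ∷ ws) f =
    ≡.trans (ℕ.*-distribˡ-+ c (f w) _) (cong (λ r → c * f w + r) (*-distribˡ-sumOver c ws f))

  Σ≤-sumOver : ∀ n ws (f : ℕ → List Step → ℕ) →
    ℕ-Sum.Σ≤ n (λ a → sumOver ws (f a)) ≡ sumOver ws (λ w → ℕ-Sum.Σ≤ n (λ a → f a w))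
  Σ≤-sumOver zero    ws f = ≡.refl
  Σ≤-sumOver (suc n) ws f = ≡.trans (cong (_+ sumOver ws (f (suc n))) (Σ≤-sumOver n ws f))
    (≡.sym (sumOver-distrib-+ ws _ (f (suc n))))

  sumOver-words-suc : ∀ n f → sumOver (words (suc n)) f ≡
    sumOver (words n) (f ∘ (U ∷_)) + sumOver (words n) (f ∘ (H ∷_)) + sumOver (words n) (f ∘ (D ∷_))
  sumOver-words-suc n f = go (words n)
    where
    go : ∀ ws → sumOver (concatMap (λ w → (U ∷ w) ∷ (H ∷ w) ∷ (D ∷ w) ∷ []) ws) f ≡
      sumOver ws (f ∘ (U ∷_)) + sumOver ws (f ∘ (H ∷_)) + sumOver ws (f ∘ (D ∷_))
    go []       = ≡.refl
    go (w ∷ ws) rewrite go ws = regroup (f (U ∷ w)) (f (H ∷ w)) (f (D ∷ w)) _ _ _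
      where
      regroup : ∀ a b c x y z → a + (b + (c + (x + y + z))) ≡ (a + x) + (b + y) + (c + z)
      regroup = solve-∀

  sumOver-words-take-drop : ∀ m r (F G : List Step → ℕ) →
    sumOver (words (m + r)) (λ w → F (take m w) * G (drop m w)) ≡ sumOver (words m) F * sumOver (words r) G
  sumOver-words-take-drop zero    r F G = ≡.trans (≡.sym (*-distribˡ-sumOver (F []) (words r) G))
    (cong (_* sumOver (words r) G) (≡.sym (ℕ.+-identityʳ (F []))))
  sumOver-words-take-drop (suc m) r F G = begin
    sumOver (words (suc (m + r))) (λ w → F (take (suc m) w) * G (drop (suc m) w))
      ≡⟨ sumOver-words-suc (m + r) _ ⟩
    sumOver (words (m + r)) (λ w → F (U ∷ take m w) * G (drop m w))
      + sumOver (words (m + r)) (λ w → F (H ∷ take m w) * G (drop m w))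
      + sumOver (words (m + r)) (λ w → F (D ∷ take m w) * G (drop m w))
      ≡⟨ cong₂ _+_ (cong₂ _+_ (IH U) (IH H)) (IH D) ⟩
    Fₛ U * S + Fₛ H * S + Fₛ D * S
      ≡⟨ ≡.trans (cong (_+ Fₛ D * S) (≡.sym (ℕ.*-distribʳ-+ S (Fₛ U) (Fₛ H))))
                 (≡.sym (ℕ.*-distribʳ-+ S (Fₛ U + Fₛ H) (Fₛ D))) ⟩
    (Fₛ U + Fₛ H + Fₛ D) * S
      ≡⟨ cong (_* S) (sumOver-words-suc m F) ⟨
    sumOver (words (suc m)) F * S ∎
    where
    S = sumOver (words r) G
    Fₛ : Step → ℕ
    Fₛ s = sumOver (words m) (F ∘ (s ∷_))
    IH : ∀ s → sumOver (words (m + r)) (λ w → F (s ∷ take m w) * G (drop m w)) ≡ Fₛ s * S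
    IH s = sumOver-words-take-drop m r (F ∘ (s ∷_)) G

module FirstPassage where
  open import Data.Bool using (Bool; true; false; _∧_; T)
  open import Data.Bool.Properties using (T-∧; ∧-zeroʳ)
  open import Data.List using (List; []; _∷_; _++_; length)
  open import Data.List.Properties using (∷-injectiveʳ)
  open import Data.Nat using (_+_; _*_)
  open import Data.Nat.Tactic.RingSolver using (solve-∀)
  open import Function.Bundles using (Equivalence)
  open ≡ using (cong)

  ∧-proj : ∀ {a b} → T (a ∧ b) → T a × T b
  ∧-proj = Equivalence.to T-∧

  ∧-intro : ∀ {a b} → T a → T b → T (a ∧ b)
  ∧-intro p q = Equivalence.from T-∧ (p , q)

  allowedAfter : Step → Step → Bool
  allowedAfter U D = false
  allowedAfter D U = false
  allowedAfter _ _ = true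

  -- firstPassage h l w: starting at height h right after a step l, the path w stays strictly
  -- above the x-axis until its last step reaches it, and has no factor UD or DU (also with l).
  firstPassage : ℕ → Step → List Step → Bool
  firstPassage zero          l w           = false
  firstPassage (suc h)       l []          = false
  firstPassage (suc h)       l (U ∷ w)     = allowedAfter l U ∧ firstPassage (suc (suc h)) U w
  firstPassage (suc h)       l (H ∷ w)     = firstPassage (suc h) H w
  firstPassage (suc zero)    l (D ∷ [])    = allowedAfter l D
  firstPassage (suc zero)    l (D ∷ _ ∷ _) = false
  firstPassage (suc (suc h)) l (D ∷ w)     = allowedAfter l D ∧ firstPassage (suc h) D w

  stays∧noPeakValley≡firstPassage : ∀ h l w → stays h w ∧ noPeakValley (l ∷ w) ≡ firstPassage h l w
  stays∧noPeakValley≡firstPassage zero          l w           = ≡.refl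
  stays∧noPeakValley≡firstPassage (suc h)       l []          = ≡.refl
  stays∧noPeakValley≡firstPassage (suc h)       U (U ∷ w)     = stays∧noPeakValley≡firstPassage (suc (suc h)) U w
  stays∧noPeakValley≡firstPassage (suc h)       H (U ∷ w)     = stays∧noPeakValley≡firstPassage (suc (suc h)) U w
  stays∧noPeakValley≡firstPassage (suc h)       D (U ∷ w)     = ∧-zeroʳ _
  stays∧noPeakValley≡firstPassage (suc h)       U (H ∷ w)     = stays∧noPeakValley≡firstPassage (suc h) H w
  stays∧noPeakValley≡firstPassage (suc h)       H (H ∷ w)     = stays∧noPeakValley≡firstPassage (suc h) H w
  stays∧noPeakValley≡firstPassage (suc h)       D (H ∷ w)     = stays∧noPeakValley≡firstPassage (suc h) H w
  stays∧noPeakValley≡firstPassage (suc zero)    U (D ∷ [])    = ≡.refl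
  stays∧noPeakValley≡firstPassage (suc zero)    H (D ∷ [])    = ≡.refl
  stays∧noPeakValley≡firstPassage (suc zero)    D (D ∷ [])    = ≡.refl
  stays∧noPeakValley≡firstPassage (suc zero)    l (D ∷ _ ∷ _) = ≡.refl
  stays∧noPeakValley≡firstPassage (suc (suc h)) U (D ∷ w)     = ∧-zeroʳ _
  stays∧noPeakValley≡firstPassage (suc (suc h)) H (D ∷ w)     = stays∧noPeakValley≡firstPassage (suc h) D w
  stays∧noPeakValley≡firstPassage (suc (suc h)) D (D ∷ w)     = stays∧noPeakValley≡firstPassage (suc h) D w

  firstPassage-++ : ∀ g h l u v → T (firstPassage (suc g) l u) → T (firstPassage (suc h) D v) →
    T (firstPassage (suc g + suc h) l (u ++ v))
  firstPassage-++ g       h l (U ∷ u)     v pu pv =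
    let l↝U , pu′ = ∧-proj pu in ∧-intro l↝U (firstPassage-++ (suc g) h U u v pu′ pv)
  firstPassage-++ g       h l (H ∷ u)     v pu pv = firstPassage-++ g h H u v pu pv
  firstPassage-++ zero    h l (D ∷ [])    v pu pv = ∧-intro pu pv
  firstPassage-++ (suc g) h l (D ∷ u)     v pu pv =
    let l↝D , pu′ = ∧-proj pu in ∧-intro l↝D (firstPassage-++ g h D u v pu′ pv)

  firstPassage-split : ∀ g h l w → T (firstPassage (suc g + suc h) l w) →
    Σ (List Step) λ u → Σ (List Step) λ v →
      w ≡ u ++ v × T (firstPassage (suc g) l u) × T (firstPassage (suc h) D v)
  firstPassage-split g h l (U ∷ w) p with ∧-proj p
  ... | l↝U , p′ with firstPassage-split (suc g) h U w p′
  ...   | u , v , ≡.refl , pu , pv = U ∷ u , v , ≡.refl , ∧-intro l↝U pu , pv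
  firstPassage-split g h l (H ∷ w) p with firstPassage-split g h H w p
  ... | u , v , ≡.refl , pu , pv = H ∷ u , v , ≡.refl , pu , pv
  firstPassage-split zero h l (D ∷ w) p with ∧-proj p
  ... | l↝D , pw = D ∷ [] , w , ≡.refl , l↝D , pw
  firstPassage-split (suc g) h l (D ∷ w) p with ∧-proj p
  ... | l↝D , p′ with firstPassage-split g h D w p′
  ...   | u , v , ≡.refl , pu , pv = D ∷ u , v , ≡.refl , ∧-intro l↝D pu , pv

  firstPassage-prefix : ∀ g l u u′ {v v′} → T (firstPassage (suc g) l u) → T (firstPassage (suc g) l u′) →
    u ++ v ≡ u′ ++ v′ → u ≡ u′
  firstPassage-prefix g l (U ∷ u) (U ∷ u′) pu pu′ eq = cong (U ∷_)
    (firstPassage-prefix (suc g) U u u′ (proj₂ (∧-proj pu)) (proj₂ (∧-proj pu′)) (∷-injectiveʳ eq))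
  firstPassage-prefix g l (H ∷ u) (H ∷ u′) pu pu′ eq = cong (H ∷_)
    (firstPassage-prefix g H u u′ pu pu′ (∷-injectiveʳ eq))
  firstPassage-prefix zero l (D ∷ []) (D ∷ []) pu pu′ eq = ≡.refl
  firstPassage-prefix (suc g) l (D ∷ u) (D ∷ u′) pu pu′ eq = cong (D ∷_)
    (firstPassage-prefix g D u u′ (proj₂ (∧-proj pu)) (proj₂ (∧-proj pu′)) (∷-injectiveʳ eq))
  firstPassage-prefix g l (U ∷ u) (H ∷ u′) pu pu′ ()
  firstPassage-prefix g l (U ∷ u) (D ∷ u′) pu pu′ ()
  firstPassage-prefix g l (H ∷ u) (U ∷ u′) pu pu′ ()
  firstPassage-prefix g l (H ∷ u) (D ∷ u′) pu pu′ ()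
  firstPassage-prefix g l (D ∷ u) (U ∷ u′) pu pu′ ()
  firstPassage-prefix g l (D ∷ u) (H ∷ u′) pu pu′ ()
  firstPassage-prefix zero l (D ∷ []) (D ∷ _ ∷ _) pu () eq
  firstPassage-prefix zero l (D ∷ _ ∷ _) (D ∷ u′) () pu′ eq

  firstPassage-length : ∀ g l u → T (firstPassage (suc g) l u) → length u ≡ suc g + (#H u + 2 * #U u)
  firstPassage-length g       l (U ∷ u) p = ≡.trans (cong suc (firstPassage-length (suc g) U u (proj₂ (∧-proj p))))
    (length-U g (#H u) (#U u))
    where
    length-U : ∀ g a b → suc (suc (suc g) + (a + 2 * b)) ≡ suc g + (a + 2 * suc b)
    length-U = solve-∀
  firstPassage-length g       l (H ∷ u) p = ≡.trans (cong suc (firstPassage-length g H u p)) (length-H g (#H u) (#U u))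
    where
    length-H : ∀ g a b → suc (suc g + (a + 2 * b)) ≡ suc g + (suc a + 2 * b)
    length-H = solve-∀
  firstPassage-length zero    l (D ∷ []) p = ≡.refl
  firstPassage-length (suc g) l (D ∷ u) p = cong suc (firstPassage-length g D u (proj₂ (∧-proj p)))

  xfd-++ : ∀ g l u v → T (firstPassage (suc g) l u) → xfd (u ++ v) ≡ xfd u
  xfd-++ g l (U ∷ u) v p = xfd-++ (suc g) U u v (proj₂ (∧-proj p))
  xfd-++ g l (H ∷ u) v p = cong suc (xfd-++ g H u v p)
  xfd-++ g l (D ∷ u) v p = ≡.refl

  #H-++ : ∀ u v → #H (u ++ v) ≡ #H u + #H v
  #H-++ []      v = ≡.refl
  #H-++ (U ∷ u) v = #H-++ u v
  #H-++ (H ∷ u) v = cong suc (#H-++ u v)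
  #H-++ (D ∷ u) v = #H-++ u v

  #U-++ : ∀ u v → #U (u ++ v) ≡ #U u + #U v
  #U-++ []      v = ≡.refl
  #U-++ (U ∷ u) v = cong suc (#U-++ u v)
  #U-++ (H ∷ u) v = #U-++ u v
  #U-++ (D ∷ u) v = #U-++ u v

module PathSeries where
  open Words
  open FirstPassage
  open import Data.Bool using (Bool; true; false; _∧_; T)
  open import Data.List using (List; []; _∷_; _++_; take; drop; length; filterᵇ)
  open import Data.List.Properties using (take++drop≡id)
  open import Data.Nat using (_+_; _*_; _≡ᵇ_)
  open import Data.Nat.Tactic.RingSolver using (solve-∀)
  open import Relation.Nullary using (¬_)
  open import Relation.Nullary.Decidable using (T?)
  open import Data.Unit using (tt)
  open ≡ using (cong; cong₂)

  tExponent : Bool → List Step → ℕ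
  tExponent true  w = xfd w
  tExponent false w = 0

  hasWeight : Bool → ℕ → ℕ → ℕ → List Step → Bool
  hasWeight τ i j k w = (tExponent τ w ≡ᵇ i) ∧ (#H w ≡ᵇ j) ∧ (#U w ≡ᵇ k)

  hasWeight⇒ : ∀ τ i j k w → T (hasWeight τ i j k w) → tExponent τ w ≡ i × #H w ≡ j × #U w ≡ k
  hasWeight⇒ τ i j k w p =
    let tᵢ , rest = ∧-proj p ; hⱼ , uₖ = ∧-proj rest
    in ℕ.≡ᵇ⇒≡ _ i tᵢ , ℕ.≡ᵇ⇒≡ _ j hⱼ , ℕ.≡ᵇ⇒≡ _ k uₖ

  ⇒hasWeight : ∀ τ i j k w → tExponent τ w ≡ i → #H w ≡ j → #U w ≡ k → T (hasWeight τ i j k w)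
  ⇒hasWeight τ i j k w tᵢ hⱼ uₖ =
    ∧-intro (ℕ.≡⇒≡ᵇ _ i tᵢ) (∧-intro (ℕ.≡⇒≡ᵇ _ j hⱼ) (ℕ.≡⇒≡ᵇ _ k uₖ))

  -- A first passage from height h with j steps H and k steps U has length h + j + 2k.
  pathCount : ℕ → Step → Bool → ℕ → ℕ → ℕ → ℕ
  pathCount h l τ i j k =
    sumOver (words (h + (j + 2 * k))) λ w → indicator (firstPassage h l w ∧ hasWeight τ i j k w)

  pathSeries : ℕ → Step → Bool → FPS
  pathSeries h l τ i j k = + pathCount h l τ i j k

  indicator-true : ∀ {p} → T p → indicator p ≡ 1
  indicator-true {true} _ = ≡.refl

  indicator-false : ∀ {p} → ¬ T p → indicator p ≡ 0
  indicator-false {true}  ¬p = ⊥-elim (¬p tt)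
  indicator-false {false} _  = ≡.refl

  indicator-∧ : ∀ p q → indicator (p ∧ q) ≡ indicator p * indicator q
  indicator-∧ true  q = ≡.sym (ℕ.+-identityʳ _)
  indicator-∧ false q = ≡.refl

  indicator-wrongWeight : ∀ p τ i j k w → ¬ (tExponent τ w ≡ i × #H w ≡ j × #U w ≡ k) →
    indicator (p ∧ hasWeight τ i j k w) ≡ 0
  indicator-wrongWeight p τ i j k w ≢ = indicator-false (≢ ∘ hasWeight⇒ τ i j k w ∘ proj₂ ∘ ∧-proj {p})

  tExponent-++ : ∀ τ u v → T (firstPassage 1 U u) → tExponent τ (u ++ v) ≡ tExponent τ u
  tExponent-++ true  u v pu = xfd-++ 0 U u v pu
  tExponent-++ false u v pu = ≡.refl

  -- A first passage from height 2 splits uniquely, at its first return to height 1, into a first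
  -- passage from height 1 and one from height 1 after a D; the first descent lies in the first part.
  module Factorisation (τ : Bool) (i j k : ℕ) where

    whole : List Step → Bool
    whole w = firstPassage 2 U w ∧ hasWeight τ i j k w

    firstPart : ℕ → ℕ → ℕ → List Step → Bool
    firstPart a b c u = firstPassage 1 U u ∧ hasWeight τ a b c u

    secondPart : ℕ → ℕ → ℕ → List Step → Bool
    secondPart a b c v = firstPassage 1 D v ∧ hasWeight false (i ∸ a) (j ∸ b) (k ∸ c) v

    cut : ℕ → ℕ → ℕ
    cut b c = 1 + (b + 2 * c)

    splitsAs : ℕ → ℕ → ℕ → List Step → Bool
    splitsAs a b c w = firstPart a b c (take (cut b c) w) ∧ secondPart a b c (drop (cut b c) w)

    splitsAs⇒whole : ∀ {a b c} w → a ≤ i → b ≤ j → c ≤ k → T (splitsAs a b c w) → T (whole w)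
    splitsAs⇒whole {a} {b} {c} w a≤i b≤j c≤k p = ≡.subst (T ∘ whole) (take++drop≡id (cut b c) w)
      (∧-intro (firstPassage-++ 0 0 U u v pu pv)
        (⇒hasWeight τ i j k (u ++ v) tExp≡i
          (≡.trans (#H-++ u v) (≡.trans (cong₂ _+_ hu hv) (ℕ.m+[n∸m]≡n b≤j)))
          (≡.trans (#U-++ u v) (≡.trans (cong₂ _+_ uu uv) (ℕ.m+[n∸m]≡n c≤k)))))
      where
      u = take (cut b c) w
      v = drop (cut b c) w
      first : T (firstPassage 1 U u) × T (hasWeight τ a b c u)
      first = ∧-proj (proj₁ (∧-proj {firstPart a b c u} p))
      second : T (firstPassage 1 D v) × T (hasWeight false (i ∸ a) (j ∸ b) (k ∸ c) v)
      second = ∧-proj (proj₂ (∧-proj {firstPart a b c u} p))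
      pu = proj₁ first
      pv = proj₁ second
      weight-u = hasWeight⇒ τ a b c u (proj₂ first)
      weight-v = hasWeight⇒ false (i ∸ a) (j ∸ b) (k ∸ c) v (proj₂ second)
      hu = proj₁ (proj₂ weight-u)
      uu = proj₂ (proj₂ weight-u)
      hv = proj₁ (proj₂ weight-v)
      uv = proj₂ (proj₂ weight-v)
      tExp≡i : tExponent τ (u ++ v) ≡ i
      tExp≡i = ≡.trans (tExponent-++ τ u v pu) (≡.trans (proj₁ weight-u)
        (ℕ.≤-antisym a≤i (ℕ.m∸n≡0⇒m≤n (≡.sym (proj₁ weight-v)))))

    module Decomposed {w} (u v : List Step) (whole-w : T (whole w)) (w≡u++v : w ≡ u ++ v)
             (pu : T (firstPassage 1 U u)) (pv : T (firstPassage 1 D v)) where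

      private
        weight-w = hasWeight⇒ τ i j k w (proj₂ (∧-proj {firstPassage 2 U w} whole-w))

        tExp-u : tExponent τ u ≡ i
        tExp-u = ≡.trans (≡.sym (tExponent-++ τ u v pu))
          (≡.trans (cong (tExponent τ) (≡.sym w≡u++v)) (proj₁ weight-w))

        #H-uv : #H u + #H v ≡ j
        #H-uv = ≡.trans (≡.sym (#H-++ u v)) (≡.trans (cong #H (≡.sym w≡u++v)) (proj₁ (proj₂ weight-w)))

        #U-uv : #U u + #U v ≡ k
        #U-uv = ≡.trans (≡.sym (#U-++ u v)) (≡.trans (cong #U (≡.sym w≡u++v)) (proj₂ (proj₂ weight-w)))

      #H≤j : #H u ≤ j
      #H≤j = ≡.subst (#H u ≤_) #H-uv (ℕ.m≤m+n (#H u) _)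

      #U≤k : #U u ≤ k
      #U≤k = ≡.subst (#U u ≤_) #U-uv (ℕ.m≤m+n (#U u) _)

      splitsAs-unique : ∀ a b c → T (splitsAs a b c w) → (a , b , c) ≡ (i , #H u , #U u)
      splitsAs-unique a b c p =
        cong₂ _,_ (≡.trans (≡.sym tᵃ) (≡.trans (cong (tExponent τ) prefix) tExp-u))
                  (cong₂ _,_ (≡.trans (≡.sym hᵇ) (cong #H prefix)) (≡.trans (≡.sym uᶜ) (cong #U prefix)))
        where
        first = ∧-proj (proj₁ (∧-proj {firstPart a b c (take (cut b c) w)} p))
        prefix : take (cut b c) w ≡ u
        prefix = firstPassage-prefix 0 U _ u (proj₁ first) pu (≡.trans (take++drop≡id (cut b c) w) w≡u++v)
        weight = hasWeight⇒ τ a b c _ (proj₂ first)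
        tᵃ = proj₁ weight
        hᵇ = proj₁ (proj₂ weight)
        uᶜ = proj₂ (proj₂ weight)

      splitsAs-decomposition : T (splitsAs i (#H u) (#U u) w)
      splitsAs-decomposition = ≡.subst (T ∘ splitsAs i (#H u) (#U u)) (≡.sym w≡u++v) on-u++v
        where
        on-u++v : T (splitsAs i (#H u) (#U u) (u ++ v))
        on-u++v rewrite ≡.sym (firstPassage-length 0 U u pu) | take-length-++ u v | drop-length-++ u v =
          ∧-intro (∧-intro pu (⇒hasWeight τ i _ _ u tExp-u ≡.refl ≡.refl))
                  (∧-intro pv (⇒hasWeight false _ _ _ v (≡.sym (ℕ.n∸n≡0 i))
                    (≡.sym (≡.trans (cong (_∸ #H u) (≡.sym #H-uv)) (ℕ.m+n∸m≡n (#H u) _)))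
                    (≡.sym (≡.trans (cong (_∸ #U u) (≡.sym #U-uv)) (ℕ.m+n∸m≡n (#U u) _)))))

    Σ³ : (ℕ → ℕ → ℕ → ℕ) → ℕ
    Σ³ f = ℕ-Sum.Σ≤ i (λ a → ℕ-Sum.Σ≤ j (λ b → ℕ-Sum.Σ≤ k (λ c → f a b c)))

    Σ³-splitsAs : ∀ w → Σ³ (λ a b c → indicator (splitsAs a b c w)) ≡ indicator (whole w)
    Σ³-splitsAs w with T? (whole w)
    ... | no ¬whole = ≡.trans
      (ℕ-Sum.Σ≤-zero i λ a a≤i → ℕ-Sum.Σ≤-zero j λ b b≤j → ℕ-Sum.Σ≤-zero k λ c c≤k →
         indicator-false (¬whole ∘ splitsAs⇒whole w a≤i b≤j c≤k))
      (≡.sym (indicator-false ¬whole))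
    ... | yes whole-w with firstPassage-split 0 0 U w (proj₁ (∧-proj {firstPassage 2 U w} whole-w))
    ...   | u , v , w≡u++v , pu , pv = ≡.trans
      (ℕ-Sum.Σ≤³-single i j k (λ a b c → indicator (splitsAs a b c w)) ℕ.≤-refl #H≤j #U≤k
         λ a b c _ _ _ ≢ → indicator-false (≢ ∘ splitsAs-unique a b c))
      (≡.trans (indicator-true splitsAs-decomposition) (≡.sym (indicator-true whole-w)))
      where open Decomposed u v whole-w w≡u++v pu pv

    count-product : ∀ a b c → b ≤ j → c ≤ k →
      pathCount 1 U τ a b c * pathCount 1 D false (i ∸ a) (j ∸ b) (k ∸ c)
        ≡ sumOver (words (2 + (j + 2 * k))) (indicator ∘ splitsAs a b c)
    count-product a b c b≤j c≤k = begin
      pathCount 1 U τ a b c * pathCount 1 D false (i ∸ a) (j ∸ b) (k ∸ c)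
        ≡⟨ sumOver-words-take-drop (cut b c) rest (indicator ∘ firstPart a b c) (indicator ∘ secondPart a b c) ⟨
      sumOver (words (cut b c + rest))
        (λ w → indicator (firstPart a b c (take (cut b c) w)) * indicator (secondPart a b c (drop (cut b c) w)))
        ≡⟨ sumOver-cong (words (cut b c + rest)) (λ w → ≡.sym (indicator-∧
             (firstPart a b c (take (cut b c) w)) (secondPart a b c (drop (cut b c) w)))) ⟩
      sumOver (words (cut b c + rest)) (indicator ∘ splitsAs a b c)
        ≡⟨ cong (λ n → sumOver (words n) (indicator ∘ splitsAs a b c)) total-length ⟩
      sumOver (words (2 + (j + 2 * k))) (indicator ∘ splitsAs a b c) ∎
      where
      open ≡.≡-Reasoning
      rest = 1 + ((j ∸ b) + 2 * (k ∸ c))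
      regroup : ∀ b′ j′ c′ k′ → 1 + (b′ + 2 * c′) + (1 + (j′ + 2 * k′)) ≡ 2 + ((b′ + j′) + 2 * (c′ + k′))
      regroup = solve-∀
      total-length : cut b c + rest ≡ 2 + (j + 2 * k)
      total-length = ≡.trans (regroup b (j ∸ b) c (k ∸ c))
        (cong₂ (λ m n → 2 + (m + 2 * n)) (ℕ.m+[n∸m]≡n b≤j) (ℕ.m+[n∸m]≡n c≤k))

    pathCount-two : pathCount 2 U τ i j k ≡
      Σ³ (λ a b c → pathCount 1 U τ a b c * pathCount 1 D false (i ∸ a) (j ∸ b) (k ∸ c))
    pathCount-two = begin
      sumOver (words n) (indicator ∘ whole)
        ≡⟨ sumOver-cong (words n) Σ³-splitsAs ⟨
      sumOver (words n) (λ w → Σ³ (λ a b c → indicator (splitsAs a b c w)))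
        ≡⟨ Σ³-sumOver ⟨
      Σ³ (λ a b c → sumOver (words n) (indicator ∘ splitsAs a b c))
        ≡⟨ ℕ-Sum.Σ≤-cong i (λ a _ → ℕ-Sum.Σ≤-cong j λ b b≤j → ℕ-Sum.Σ≤-cong k λ c c≤k →
             ≡.sym (count-product a b c b≤j c≤k)) ⟩
      Σ³ (λ a b c → pathCount 1 U τ a b c * pathCount 1 D false (i ∸ a) (j ∸ b) (k ∸ c)) ∎
      where
      open ≡.≡-Reasoning
      n = 2 + (j + 2 * k)
      φ : ℕ → ℕ → ℕ → List Step → ℕ
      φ a b c = indicator ∘ splitsAs a b c
      Σ³-sumOver : Σ³ (λ a b c → sumOver (words n) (φ a b c))
                 ≡ sumOver (words n) (λ w → Σ³ (λ a b c → φ a b c w))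
      Σ³-sumOver = ≡.trans
        (ℕ-Sum.Σ≤-cong i λ a _ → ≡.trans
          (ℕ-Sum.Σ≤-cong j λ b _ → Σ≤-sumOver k (words n) (φ a b))
          (Σ≤-sumOver j (words n) λ b w → ℕ-Sum.Σ≤ k (λ c → φ a b c w)))
        (Σ≤-sumOver i (words n) λ a w → ℕ-Sum.Σ≤ j (λ b → ℕ-Sum.Σ≤ k (λ c → φ a b c w)))

  +-Σ≤ : ∀ n f → + ℕ-Sum.Σ≤ n f ≡ ℤ⟦y⟧.Σ≤ n (λ a → + f a)
  +-Σ≤ zero    f = ≡.refl
  +-Σ≤ (suc n) f = ≡.trans (ℤ.pos-+ (ℕ-Sum.Σ≤ n f) (f (suc n))) (cong (ℤ._+ + f (suc n)) (+-Σ≤ n f))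

  pathSeries-two : ∀ τ → pathSeries 2 U τ ≋ pathSeries 1 U τ ⊛ pathSeries 1 D false
  pathSeries-two τ i j k = begin
    + pathCount 2 U τ i j k
      ≡⟨ cong +_ pathCount-two ⟩
    + Σ³ (λ a b c → pathCount 1 U τ a b c * pathCount 1 D false (i ∸ a) (j ∸ b) (k ∸ c))
      ≡⟨ ≡.trans (+-Σ≤ i _) (ℤ⟦y⟧.Σ≤-cong i λ a _ → ≡.trans (+-Σ≤ j _) (ℤ⟦y⟧.Σ≤-cong j λ b _ →
           ≡.trans (+-Σ≤ k _) (ℤ⟦y⟧.Σ≤-cong k λ c _ →
             ℤ.pos-* (pathCount 1 U τ a b c) (pathCount 1 D false (i ∸ a) (j ∸ b) (k ∸ c))))) ⟩
    ℤ⟦y⟧.Σ≤ i (λ a → ℤ⟦y⟧.Σ≤ j (λ b → ℤ⟦y⟧.Σ≤ k (λ c →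
      pathSeries 1 U τ a b c ℤ.* pathSeries 1 D false (i ∸ a) (j ∸ b) (k ∸ c))))
      ≡⟨ sumTo³≡Σ≤³ i j k
           (λ a b c → pathSeries 1 U τ a b c ℤ.* pathSeries 1 D false (i ∸ a) (j ∸ b) (k ∸ c)) ⟨
    (pathSeries 1 U τ ⊛ pathSeries 1 D false) i j k ∎
    where
    open ≡.≡-Reasoning
    open Factorisation τ i j k using (pathCount-two; Σ³)

  tExponent-D : ∀ τ → tExponent τ (D ∷ []) ≡ 0
  tExponent-D true  = ≡.refl
  tExponent-D false = ≡.refl

  stepCount : Step → Step → Bool → ℕ → ℕ → ℕ → ℕ
  stepCount s l τ i j k =
    sumOver (words (j + 2 * k)) λ w → indicator (firstPassage 1 l (s ∷ w) ∧ hasWeight τ i j k (s ∷ w))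

  stepSeries : Step → Step → Bool → FPS
  stepSeries s l τ i j k = + stepCount s l τ i j k

  pathSeries-first-step : ∀ l τ → pathSeries 1 l τ ≋ stepSeries U l τ ⊕ stepSeries H l τ ⊕ stepSeries D l τ
  pathSeries-first-step l τ i j k = ≡.trans (cong +_ (sumOver-words-suc (j + 2 * k) _))
    (≡.trans (ℤ.pos-+ (stepCount U l τ i j k + stepCount H l τ i j k) _)
             (cong (ℤ._+ stepSeries D l τ i j k) (ℤ.pos-+ (stepCount U l τ i j k) _)))

  length-U : ∀ j k → j + 2 * suc k ≡ 2 + (j + 2 * k)
  length-U = solve-∀

  firstStep-U : ∀ l τ i j k w → T (allowedAfter l U) →
    firstPassage 1 l (U ∷ w) ∧ hasWeight τ i j (suc k) (U ∷ w) ≡ firstPassage 2 U w ∧ hasWeight τ i j k w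
  firstStep-U U true  i j k w _ = ≡.refl
  firstStep-U U false i j k w _ = ≡.refl
  firstStep-U H true  i j k w _ = ≡.refl
  firstStep-U H false i j k w _ = ≡.refl

  stepSeries-U : ∀ l τ → T (allowedAfter l U) → stepSeries U l τ ≋ 𝕪 ⊛ pathSeries 2 U τ
  stepSeries-U l τ l↝U i j zero    = ≡.trans
    (cong +_ (sumOver-zero (words (j + 0)) λ w →
      indicator-wrongWeight (firstPassage 1 l (U ∷ w)) τ i j 0 (U ∷ w) (ℕ.1+n≢0 ∘ proj₂ ∘ proj₂)))
    (≡.sym (𝕪-⊛-zero (pathSeries 2 U τ) i j))
  stepSeries-U l τ l↝U i j (suc k) = ≡.trans (cong +_ (≡.trans
    (sumOver-cong (words (j + 2 * suc k)) λ w → cong indicator (firstStep-U l τ i j k w l↝U))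
    (cong (λ n → sumOver (words n) λ w → indicator (firstPassage 2 U w ∧ hasWeight τ i j k w)) (length-U j k))))
    (≡.sym (𝕪-⊛-suc (pathSeries 2 U τ) i j k))

  stepSeries-U-after-D : ∀ τ → stepSeries U D τ ≋ FPS-Ring.0#
  stepSeries-U-after-D τ i j k = cong +_ (sumOver-zero (words (j + 2 * k)) λ w → ≡.refl)

  stepSeries-H-untracked : ∀ l → stepSeries H l false ≋ 𝕩 ⊛ pathSeries 1 H false
  stepSeries-H-untracked l i zero    k = ≡.trans
    (cong +_ (sumOver-zero (words (2 * k)) λ w →
      indicator-wrongWeight (firstPassage 1 H w) false i 0 k (H ∷ w) (ℕ.1+n≢0 ∘ proj₁ ∘ proj₂)))
    (≡.sym (𝕩-⊛-zero (pathSeries 1 H false) i k))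
  stepSeries-H-untracked l i (suc j) k = ≡.sym (𝕩-⊛-suc (pathSeries 1 H false) i j k)

  stepSeries-H-tracked : ∀ l → stepSeries H l true ≋ 𝕥 ⊛ (𝕩 ⊛ pathSeries 1 H true)
  stepSeries-H-tracked l zero    j       k = ≡.trans
    (cong +_ (sumOver-zero (words (j + 2 * k)) λ w →
      indicator-wrongWeight (firstPassage 1 H w) true 0 j k (H ∷ w) (ℕ.1+n≢0 ∘ proj₁)))
    (≡.sym (𝕥-⊛-zero (𝕩 ⊛ pathSeries 1 H true) j k))
  stepSeries-H-tracked l (suc i) zero    k = ≡.trans
    (cong +_ (sumOver-zero (words (2 * k)) λ w →
      indicator-wrongWeight (firstPassage 1 H w) true (suc i) 0 k (H ∷ w) (ℕ.1+n≢0 ∘ proj₁ ∘ proj₂)))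
    (≡.sym (≡.trans (𝕥-⊛-suc (𝕩 ⊛ pathSeries 1 H true) i 0 k) (𝕩-⊛-zero (pathSeries 1 H true) i k)))
  stepSeries-H-tracked l (suc i) (suc j) k =
    ≡.sym (≡.trans (𝕥-⊛-suc (𝕩 ⊛ pathSeries 1 H true) i (suc j) k) (𝕩-⊛-suc (pathSeries 1 H true) i j k))

  stepSeries-D-after-U : ∀ τ → stepSeries D U τ ≋ FPS-Ring.0#
  stepSeries-D-after-U τ i j k = cong +_ (sumOver-zero (words (j + 2 * k)) λ where
    []      → ≡.refl
    (_ ∷ _) → ≡.refl)

  stepCount-D-vanishes : ∀ l τ i j k → (i , j , k) ≢ (0 , 0 , 0) → stepCount D l τ i j k ≡ 0
  stepCount-D-vanishes l τ i j k ≢ = sumOver-zero (words (j + 2 * k)) λ where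
    []      → indicator-wrongWeight (allowedAfter l D) τ i j k (D ∷ []) λ where
                (t≡i , ≡.refl , ≡.refl) → ≢ (cong (_, 0 , 0) (≡.trans (≡.sym t≡i) (tExponent-D τ)))
    (_ ∷ _) → ≡.refl

  stepSeries-D : ∀ l τ → T (allowedAfter l D) → stepSeries D l τ ≋ 𝟙
  stepSeries-D l τ l↝D zero    zero    zero    =
    cong (λ n → + (n + 0))
      (indicator-true (∧-intro l↝D (⇒hasWeight τ 0 0 0 (D ∷ []) (tExponent-D τ) ≡.refl ≡.refl)))
  stepSeries-D l τ l↝D zero    zero    (suc k) = cong +_ (stepCount-D-vanishes l τ 0 0 (suc k) λ ())
  stepSeries-D l τ l↝D zero    (suc j) k       = cong +_ (stepCount-D-vanishes l τ 0 (suc j) k λ ())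
  stepSeries-D l τ l↝D (suc i) j       k       = cong +_ (stepCount-D-vanishes l τ (suc i) j k λ ())

  isBargraph∧hasWeight : ℕ → ℕ → ℕ → List Step → Bool
  isBargraph∧hasWeight i j k w = isBargraph w ∧ hasWeight true i j k w

  X≋𝕪⊛pathSeries : X ≋ 𝕪 ⊛ pathSeries 1 U true
  X≋𝕪⊛pathSeries i j zero    = ≡.trans
    (cong +_ (≡.trans (length-filterᵇ (isBargraph∧hasWeight i j 0) (words (j + 0)))
      (sumOver-zero (words (j + 0)) λ where
        (U ∷ w) → indicator-wrongWeight (isBargraph (U ∷ w)) true i j 0 (U ∷ w) (ℕ.1+n≢0 ∘ proj₂ ∘ proj₂)
        (H ∷ w) → ≡.refl
        (D ∷ w) → ≡.refl
        []      → ≡.refl)))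
    (≡.sym (𝕪-⊛-zero (pathSeries 1 U true) i j))
  X≋𝕪⊛pathSeries i j (suc k) = ≡.trans (cong +_ (begin
    length (filterᵇ (isBargraph∧hasWeight i j (suc k)) (words (j + 2 * suc k)))
      ≡⟨ length-filterᵇ _ (words (j + 2 * suc k)) ⟩
    sumOver (words (j + 2 * suc k)) (indicator ∘ isBargraph∧hasWeight i j (suc k))
      ≡⟨ cong (λ n → sumOver (words n) (indicator ∘ isBargraph∧hasWeight i j (suc k))) (length-U j k) ⟩
    sumOver (words (suc n)) (indicator ∘ isBargraph∧hasWeight i j (suc k))
      ≡⟨ sumOver-words-suc n _ ⟩
    pathCount′ + sumOver (words n) (λ _ → 0) + sumOver (words n) (λ _ → 0)
      ≡⟨ cong₂ (λ p q → pathCount′ + p + q) (sumOver-zero (words n) (λ _ → ≡.refl))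
                                            (sumOver-zero (words n) (λ _ → ≡.refl)) ⟩
    pathCount′ + 0 + 0
      ≡⟨ ≡.trans (ℕ.+-identityʳ _) (ℕ.+-identityʳ _) ⟩
    pathCount′
      ≡⟨ sumOver-cong (words n) (λ w → cong (λ p → indicator (p ∧ hasWeight true i j k w))
           (stays∧noPeakValley≡firstPassage 1 U w)) ⟩
    pathCount 1 U true i j k ∎))
    (≡.sym (𝕪-⊛-suc (pathSeries 1 U true) i j k))
    where
    open ≡.≡-Reasoning
    n = suc (j + 2 * k)
    pathCount′ = sumOver (words n) (λ w → indicator (isBargraph (U ∷ w) ∧ hasWeight true i j k w))

open PathSeries using (pathSeries; stepSeries; pathSeries-first-step; pathSeries-two; stepSeries-U;
  stepSeries-U-after-D; stepSeries-H-untracked; stepSeries-H-tracked; stepSeries-D; stepSeries-D-after-U;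
  X≋𝕪⊛pathSeries)
open FPS-Ring using (0#; setoid; +-cong; +-congˡ; +-congʳ; *-congˡ; +-identityʳ; +-identityˡ; zeroʳ)
  renaming (refl to ≋-refl; sym to ≋-sym; trans to ≋-trans)
open import Relation.Binary.Reasoning.Setoid setoid

up flat down upₜ flatₜ : FPS
up    = pathSeries 1 U false
flat  = pathSeries 1 H false
down  = pathSeries 1 D false
upₜ   = pathSeries 1 U true
flatₜ = pathSeries 1 H true

up-decomposition : up ≋ 𝕪 ⊛ (up ⊛ down) ⊕ 𝕩 ⊛ flat
up-decomposition = begin
  up
    ≈⟨ pathSeries-first-step U false ⟩
  stepSeries U U false ⊕ stepSeries H U false ⊕ stepSeries D U false
    ≈⟨ +-cong (+-cong (stepSeries-U U false _) (stepSeries-H-untracked U)) (stepSeries-D-after-U false) ⟩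
  𝕪 ⊛ pathSeries 2 U false ⊕ 𝕩 ⊛ flat ⊕ 0#
    ≈⟨ +-identityʳ _ ⟩
  𝕪 ⊛ pathSeries 2 U false ⊕ 𝕩 ⊛ flat
    ≈⟨ +-congʳ (*-congˡ {𝕪} (pathSeries-two false)) ⟩
  𝕪 ⊛ (up ⊛ down) ⊕ 𝕩 ⊛ flat ∎

flat≋up+1 : flat ≋ up ⊕ 𝟙
flat≋up+1 = begin
  flat
    ≈⟨ pathSeries-first-step H false ⟩
  stepSeries U H false ⊕ stepSeries H H false ⊕ stepSeries D H false
    ≈⟨ +-cong (+-cong (stepSeries-U H false _) (stepSeries-H-untracked H)) (stepSeries-D H false _) ⟩
  𝕪 ⊛ pathSeries 2 U false ⊕ 𝕩 ⊛ flat ⊕ 𝟙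
    ≈⟨ +-congʳ (+-congʳ (*-congˡ {𝕪} (pathSeries-two false))) ⟩
  𝕪 ⊛ (up ⊛ down) ⊕ 𝕩 ⊛ flat ⊕ 𝟙
    ≈⟨ +-congʳ up-decomposition ⟨
  up ⊕ 𝟙 ∎

down-decomposition : down ≋ 𝕩 ⊛ (up ⊕ 𝟙) ⊕ 𝟙
down-decomposition = begin
  down
    ≈⟨ pathSeries-first-step D false ⟩
  stepSeries U D false ⊕ stepSeries H D false ⊕ stepSeries D D false
    ≈⟨ +-cong (+-cong (stepSeries-U-after-D false) (stepSeries-H-untracked D)) (stepSeries-D D false _) ⟩
  0# ⊕ 𝕩 ⊛ flat ⊕ 𝟙
    ≈⟨ +-congʳ {𝟙} (+-identityˡ (𝕩 ⊛ flat)) ⟩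
  𝕩 ⊛ flat ⊕ 𝟙
    ≈⟨ +-congʳ (*-congˡ {𝕩} flat≋up+1) ⟩
  𝕩 ⊛ (up ⊕ 𝟙) ⊕ 𝟙 ∎

upₜ-decomposition : upₜ ≋ 𝕪 ⊛ (upₜ ⊛ down) ⊕ 𝕥 ⊛ (𝕩 ⊛ flatₜ)
upₜ-decomposition = begin
  upₜ
    ≈⟨ pathSeries-first-step U true ⟩
  stepSeries U U true ⊕ stepSeries H U true ⊕ stepSeries D U true
    ≈⟨ +-cong (+-cong (stepSeries-U U true _) (stepSeries-H-tracked U)) (stepSeries-D-after-U true) ⟩
  𝕪 ⊛ pathSeries 2 U true ⊕ 𝕥 ⊛ (𝕩 ⊛ flatₜ) ⊕ 0#
    ≈⟨ +-identityʳ _ ⟩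
  𝕪 ⊛ pathSeries 2 U true ⊕ 𝕥 ⊛ (𝕩 ⊛ flatₜ)
    ≈⟨ +-congʳ (*-congˡ {𝕪} (pathSeries-two true)) ⟩
  𝕪 ⊛ (upₜ ⊛ down) ⊕ 𝕥 ⊛ (𝕩 ⊛ flatₜ) ∎

flatₜ≋upₜ+1 : flatₜ ≋ upₜ ⊕ 𝟙
flatₜ≋upₜ+1 = begin
  flatₜ
    ≈⟨ pathSeries-first-step H true ⟩
  stepSeries U H true ⊕ stepSeries H H true ⊕ stepSeries D H true
    ≈⟨ +-cong (+-cong (stepSeries-U H true _) (stepSeries-H-tracked H)) (stepSeries-D H true _) ⟩
  𝕪 ⊛ pathSeries 2 U true ⊕ 𝕥 ⊛ (𝕩 ⊛ flatₜ) ⊕ 𝟙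
    ≈⟨ +-congʳ (+-congʳ (*-congˡ {𝕪} (pathSeries-two true))) ⟩
  𝕪 ⊛ (upₜ ⊛ down) ⊕ 𝕥 ⊛ (𝕩 ⊛ flatₜ) ⊕ 𝟙
    ≈⟨ +-congʳ upₜ-decomposition ⟨
  upₜ ⊕ 𝟙 ∎

open FPS-Solver using (solve; _:+_; _:*_; _:-_; con; _:=_)

⊕-⊛-absorb : ∀ r c {e} → e ≋ 0# → r ⊕ c ⊛ e ≋ r
⊕-⊛-absorb r c e≋0 = ≋-trans (+-congˡ {r} (≋-trans (*-congˡ {c} e≋0) (zeroʳ c))) (+-identityʳ r)

⊖≋0 : ∀ {a b} → a ≋ b → a ⊖ b ≋ 0#
⊖≋0 {a} {b} a≋b = ≋-trans (+-congʳ {FPS-Ring.- b} a≋b) (FPS-Ring.-‿inverseʳ b)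

up-quadratic : 𝕩 ⊛ (up ⊕ 𝟙) ⊕ 𝕪 ⊛ up ⊛ (𝕩 ⊛ (up ⊕ 𝟙) ⊕ 𝟙) ⊖ up ≋ 0#
up-quadratic = ⊖≋0 (begin
  𝕩 ⊛ (up ⊕ 𝟙) ⊕ 𝕪 ⊛ up ⊛ (𝕩 ⊛ (up ⊕ 𝟙) ⊕ 𝟙)
    ≈⟨ solve 3 (λ x y u → x :* (u :+ con (+ 1)) :+ y :* u :* (x :* (u :+ con (+ 1)) :+ con (+ 1))
                     := y :* (u :* (x :* (u :+ con (+ 1)) :+ con (+ 1))) :+ x :* (u :+ con (+ 1))) ≋-refl 𝕩 𝕪 up ⟩
  𝕪 ⊛ (up ⊛ (𝕩 ⊛ (up ⊕ 𝟙) ⊕ 𝟙)) ⊕ 𝕩 ⊛ (up ⊕ 𝟙)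
    ≈⟨ +-cong (*-congˡ {𝕪} (*-congˡ {up} down-decomposition)) (*-congˡ {𝕩} flat≋up+1) ⟨
  𝕪 ⊛ (up ⊛ down) ⊕ 𝕩 ⊛ flat
    ≈⟨ up-decomposition ⟨
  up ∎)

upₜ-linear : 𝕥 ⊛ 𝕩 ⊛ (upₜ ⊕ 𝟙) ⊕ 𝕪 ⊛ upₜ ⊛ (𝕩 ⊛ (up ⊕ 𝟙) ⊕ 𝟙) ⊖ upₜ ≋ 0#
upₜ-linear = ⊖≋0 (begin
  𝕥 ⊛ 𝕩 ⊛ (upₜ ⊕ 𝟙) ⊕ 𝕪 ⊛ upₜ ⊛ (𝕩 ⊛ (up ⊕ 𝟙) ⊕ 𝟙)
    ≈⟨ solve 5 (λ t x y u v → t :* x :* (v :+ con (+ 1)) :+ y :* v :* (x :* (u :+ con (+ 1)) :+ con (+ 1))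
                           := y :* (v :* (x :* (u :+ con (+ 1)) :+ con (+ 1))) :+ t :* (x :* (v :+ con (+ 1))))
         ≋-refl 𝕥 𝕩 𝕪 up upₜ ⟩
  𝕪 ⊛ (upₜ ⊛ (𝕩 ⊛ (up ⊕ 𝟙) ⊕ 𝟙)) ⊕ 𝕥 ⊛ (𝕩 ⊛ (upₜ ⊕ 𝟙))
    ≈⟨ +-cong (*-congˡ {𝕪} (*-congˡ {upₜ} down-decomposition)) (*-congˡ {𝕥} (*-congˡ {𝕩} flatₜ≋upₜ+1)) ⟨
  𝕪 ⊛ (upₜ ⊛ down) ⊕ 𝕥 ⊛ (𝕩 ⊛ flatₜ)
    ≈⟨ upₜ-decomposition ⟨
  upₜ ∎)

sqrtRadicand : FPS
sqrtRadicand = 𝟙 ⊖ 𝕩 ⊖ 𝕪 ⊖ 𝕩 ⊛ 𝕪 ⊖ 𝟚 ⊛ 𝕩 ⊛ 𝕪 ⊛ up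

sqrtRadicand-isSqrt : IsSqrtRadicand sqrtRadicand
sqrtRadicand-isSqrt = square , ≡.refl
  where
  square : sqrtRadicand ⊛ sqrtRadicand ≋ radicand
  square = begin
    sqrtRadicand ⊛ sqrtRadicand
      ≈⟨ solve 3 (λ x y u →
           (con (+ 1) :- x :- y :- x :* y :- con (+ 2) :* x :* y :* u)
             :* (con (+ 1) :- x :- y :- x :* y :- con (+ 2) :* x :* y :* u)
           := (con (+ 1) :- y) :* (con (+ 1) :- con (+ 2) :* x :- y :- con (+ 2) :* x :* y :+ x :* x :- x :* x :* y)
              :+ con (+ 4) :* x :* y :* (x :* (u :+ con (+ 1)) :+ y :* u :* (x :* (u :+ con (+ 1)) :+ con (+ 1)) :- u))
           ≋-refl 𝕩 𝕪 up ⟩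
    radicand ⊕ constant (+ 4) ⊛ 𝕩 ⊛ 𝕪 ⊛ (𝕩 ⊛ (up ⊕ 𝟙) ⊕ 𝕪 ⊛ up ⊛ (𝕩 ⊛ (up ⊕ 𝟙) ⊕ 𝟙) ⊖ up)
      ≈⟨ ⊕-⊛-absorb radicand (constant (+ 4) ⊛ 𝕩 ⊛ 𝕪) up-quadratic ⟩
    radicand ∎

sqrtRadicand-unique : ∀ S → IsSqrtRadicand S → S ≋ sqrtRadicand
sqrtRadicand-unique S (S² , S₀) i j k = ℤ.i-j≡0⇒i≡j _ _
  (⊛≋0⇒≋0 (S ⊖ sqrtRadicand) (S ⊕ sqrtRadicand) product
    (λ S₀+1≡0 → 2≢0 (≡.trans (≡.sym (≡.cong (ℤ._+ + 1) S₀)) S₀+1≡0)) i j k)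
  where
  2≢0 : + 2 ≢ + 0
  2≢0 ()
  product : (S ⊖ sqrtRadicand) ⊛ (S ⊕ sqrtRadicand) ≋ 0#
  product = begin
    (S ⊖ sqrtRadicand) ⊛ (S ⊕ sqrtRadicand)
      ≈⟨ solve 2 (λ s r → (s :- r) :* (s :+ r) := s :* s :- r :* r) ≋-refl S sqrtRadicand ⟩
    S ⊛ S ⊖ sqrtRadicand ⊛ sqrtRadicand
      ≈⟨ ⊖≋0 (≋-trans S² (≋-sym (proj₁ sqrtRadicand-isSqrt))) ⟩
    0# ∎

X-closedForm : 𝟚 ⊛ denom ⊛ X ≋ 𝕥 ⊛ 𝕪 ⊛ (numer₀ ⊖ sqrtRadicand)
X-closedForm = begin
  𝟚 ⊛ denom ⊛ X
    ≈⟨ *-congˡ {𝟚 ⊛ denom} X≋𝕪⊛pathSeries ⟩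
  𝟚 ⊛ denom ⊛ (𝕪 ⊛ upₜ)
    ≈⟨ solve 5 (λ t x y u v →
         con (+ 2) :* (con (+ 1) :- t :- (con (+ 1) :- t) :* y :+ (t :* t :- t) :* x :+ t :* x :* y) :* (y :* v)
         := t :* y :* ((con (+ 1) :+ x :- y :- con (+ 2) :* t :* x :- x :* y)
                       :- (con (+ 1) :- x :- y :- x :* y :- con (+ 2) :* x :* y :* u))
            :+ con (+ 2) :* y :* y :* v
               :* (x :* (u :+ con (+ 1)) :+ y :* u :* (x :* (u :+ con (+ 1)) :+ con (+ 1)) :- u)
            :+ con (+ 2) :* y :* (t :- con (+ 1) :- y :* u)
               :* (t :* x :* (v :+ con (+ 1)) :+ y :* v :* (x :* (u :+ con (+ 1)) :+ con (+ 1)) :- v))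
         ≋-refl 𝕥 𝕩 𝕪 up upₜ ⟩
  𝕥 ⊛ 𝕪 ⊛ (numer₀ ⊖ sqrtRadicand) ⊕ 𝟚 ⊛ 𝕪 ⊛ 𝕪 ⊛ upₜ ⊛ up-kernel
    ⊕ 𝟚 ⊛ 𝕪 ⊛ (𝕥 ⊖ 𝟙 ⊖ 𝕪 ⊛ up) ⊛ upₜ-kernel
    ≈⟨ ⊕-⊛-absorb _ (𝟚 ⊛ 𝕪 ⊛ (𝕥 ⊖ 𝟙 ⊖ 𝕪 ⊛ up)) upₜ-linear ⟩
  𝕥 ⊛ 𝕪 ⊛ (numer₀ ⊖ sqrtRadicand) ⊕ 𝟚 ⊛ 𝕪 ⊛ 𝕪 ⊛ upₜ ⊛ up-kernel
    ≈⟨ ⊕-⊛-absorb _ (𝟚 ⊛ 𝕪 ⊛ 𝕪 ⊛ upₜ) up-quadratic ⟩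
  𝕥 ⊛ 𝕪 ⊛ (numer₀ ⊖ sqrtRadicand) ∎
  where
  up-kernel upₜ-kernel : FPS
  up-kernel  = 𝕩 ⊛ (up ⊕ 𝟙) ⊕ 𝕪 ⊛ up ⊛ (𝕩 ⊛ (up ⊕ 𝟙) ⊕ 𝟙) ⊖ up
  upₜ-kernel = 𝕥 ⊛ 𝕩 ⊛ (upₜ ⊕ 𝟙) ⊕ 𝕪 ⊛ upₜ ⊛ (𝕩 ⊛ (up ⊕ 𝟙) ⊕ 𝟙) ⊖ upₜ

mainTheorem11 : Σ FPS IsSqrtRadicand
    × ((S : FPS) → IsSqrtRadicand S →
         𝟚 ⊛ denom ⊛ X ≋ 𝕥 ⊛ 𝕪 ⊛ (numer₀ ⊖ S))
mainTheorem11 = (sqrtRadicand , sqrtRadicand-isSqrt) , λ S isSqrt →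
  ≋-trans X-closedForm
    (*-congˡ {𝕥 ⊛ 𝕪} (+-congˡ {numer₀} (FPS-Ring.-‿cong (≋-sym (sqrtRadicand-unique S isSqrt)))))
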